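{- Let $(\mathbf{C},\otimes,\mathbf 1)$ be a symmetric monoidal category and $(X,w:X\to\mathbf 1)$ a copointed object such that (i) for every $n$ the equaliser $(M_n X,\mathrm{eq}_n:M_nX\to X^{\otimes n})$ of all symmetries of $X^{\otimes n}$ exists, and (ii) the delete chain $\mathbf 1\xleftarrow{d_0}X\xleftarrow{d_1}X^{\otimes 2}\xleftarrow{d_2}\cdots$, $d_n=X^{\otimes n}\otimes w$, has a limit $(X^\omega,\pi_{\le n}:X^\omega\to X^{\otimes n})_{n\in\mathbb N}$. Let $f:Z\to X^\omega$ satisfy $\dot\sigma\circ f=f$ for every finitely supported symmetry $\dot\sigma$ of $X^\omega$. Then for every $n$, $\pi_{\le n}\circ f$ equalises all symmetries of $X^{\otimes n}$; and, writing $(\pi_{\le n}\circ f)^\dagger:Z\to M_nX$ for the unique morphism with $\mathrm{eq}_n\circ(\pi_{\le n}\circ f)^\dagger=\pi_{\le n}\circ f$, the family $((\pi_{\le n}\circ f)^\dagger)_{n\in\mathbb N}$ is a cone on the draw-and-delete chain, i.e. $\mathrm{DD}_n\circ(\pi_{\le n+1}\circ f)^\dagger=(\pi_{\le n}\circ f)^\dagger$ for all $n$.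
   Context: Canonical isomorphisms $Y\otimes\mathbf 1\cong Y$ are left implicit. $\mathrm{DD}_n:M_{n+1}X\to M_nX$ is the unique morphism with $\mathrm{eq}_n\circ\mathrm{DD}_n=d_n\circ\mathrm{eq}_{n+1}$; the draw-and-delete chain is $\mathbf 1\xleftarrow{\mathrm{DD}_0}M_1X\xleftarrow{\mathrm{DD}_1}M_2X\cdots$. For a permutation $\sigma$ of $\{1,\dots,N\}$ and $m\ge N$, $\sigma^{\uparrow m}$ is the permutation of $\{1,\dots,m\}$ acting as $\sigma$ on $\{1,\dots,N\}$ and as the identity elsewhere, also denoting the corresponding symmetry of $X^{\otimes m}$. The finitely supported symmetry $\dot\sigma:X^\omega\to X^\omega$ is the unique morphism with $\pi_{\le m}\circ\dot\sigma=\sigma^{\uparrow m}\circ\pi_{\le m}$ for all $m\ge N$ (using that $X^\omega$ is also the limit of the truncated chain from $N$ on). -}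

module Defs where

open import Level using (Level; _⊔_) renaming (suc to lsuc)
open import Relation.Binary using (Rel; IsEquivalence)
open import Data.Nat using (ℕ; zero; suc; _≤′_; ≤′-refl; ≤′-step)
open import Data.Fin using (Fin; zero; suc)
open import Data.List using (List; []; _∷_)
open import Data.Empty using (⊥)
open import Data.Product using (Σ; _×_; _,_)

record Category (o ℓ e : Level) : Set (lsuc (o ⊔ ℓ ⊔ e)) where
  infix  4 _≈_
  infixr 9 _∘_
  field
    Obj       : Set o
    _⇒_       : Obj → Obj → Set ℓ
    _≈_       : ∀ {A B} → Rel (A ⇒ B) e
    id        : ∀ {A} → A ⇒ A
    _∘_       : ∀ {A B C} → B ⇒ C → A ⇒ B → A ⇒ C
    equiv     : ∀ {A B} → IsEquivalence (_≈_ {A} {B})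
    ∘-resp-≈  : ∀ {A B C} {f h : B ⇒ C} {g i : A ⇒ B} → f ≈ h → g ≈ i → f ∘ g ≈ h ∘ i
    assoc     : ∀ {A B C D} {f : A ⇒ B} {g : B ⇒ C} {h : C ⇒ D} → (h ∘ g) ∘ f ≈ h ∘ (g ∘ f)
    identityˡ : ∀ {A B} {f : A ⇒ B} → id ∘ f ≈ f
    identityʳ : ∀ {A B} {f : A ⇒ B} → f ∘ id ≈ f

record SymmetricMonoidalCategory (o ℓ e : Level) : Set (lsuc (o ⊔ ℓ ⊔ e)) where
  field
    category : Category o ℓ e
  open Category category public
  infixr 10 _⊗₀_ _⊗₁_
  field
    _⊗₀_ : Obj → Obj → Obj
    _⊗₁_ : ∀ {A B C D} → A ⇒ B → C ⇒ D → (A ⊗₀ C) ⇒ (B ⊗₀ D)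
    𝟙    : Obj
    ⊗-identity     : ∀ {A B} → (id {A} ⊗₁ id {B}) ≈ id
    ⊗-homomorphism : ∀ {A B C D E F} {f : A ⇒ B} {g : B ⇒ C} {h : D ⇒ E} {k : E ⇒ F} →
                     ((g ∘ f) ⊗₁ (k ∘ h)) ≈ (g ⊗₁ k) ∘ (f ⊗₁ h)
    ⊗-resp-≈       : ∀ {A B C D} {f g : A ⇒ B} {h k : C ⇒ D} → f ≈ g → h ≈ k → (f ⊗₁ h) ≈ (g ⊗₁ k)
    α⇒ : ∀ {A B C} → ((A ⊗₀ B) ⊗₀ C) ⇒ (A ⊗₀ (B ⊗₀ C))
    α⇐ : ∀ {A B C} → (A ⊗₀ (B ⊗₀ C)) ⇒ ((A ⊗₀ B) ⊗₀ C)
    λ⇒ : ∀ {A} → (𝟙 ⊗₀ A) ⇒ A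
    λ⇐ : ∀ {A} → A ⇒ (𝟙 ⊗₀ A)
    ρ⇒ : ∀ {A} → (A ⊗₀ 𝟙) ⇒ A
    ρ⇐ : ∀ {A} → A ⇒ (A ⊗₀ 𝟙)
    β  : ∀ {A B} → (A ⊗₀ B) ⇒ (B ⊗₀ A)
    α-isoˡ : ∀ {A B C} → α⇐ {A} {B} {C} ∘ α⇒ ≈ id
    α-isoʳ : ∀ {A B C} → α⇒ {A} {B} {C} ∘ α⇐ ≈ id
    λ-isoˡ : ∀ {A} → λ⇐ {A} ∘ λ⇒ ≈ id
    λ-isoʳ : ∀ {A} → λ⇒ {A} ∘ λ⇐ ≈ id
    ρ-isoˡ : ∀ {A} → ρ⇐ {A} ∘ ρ⇒ ≈ id
    ρ-isoʳ : ∀ {A} → ρ⇒ {A} ∘ ρ⇐ ≈ id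
    α-natural : ∀ {A B C D E F} {f : A ⇒ B} {g : C ⇒ D} {h : E ⇒ F} →
                α⇒ ∘ ((f ⊗₁ g) ⊗₁ h) ≈ (f ⊗₁ (g ⊗₁ h)) ∘ α⇒
    λ-natural : ∀ {A B} {f : A ⇒ B} → λ⇒ ∘ (id ⊗₁ f) ≈ f ∘ λ⇒
    ρ-natural : ∀ {A B} {f : A ⇒ B} → ρ⇒ ∘ (f ⊗₁ id) ≈ f ∘ ρ⇒
    β-natural : ∀ {A B C D} {f : A ⇒ B} {g : C ⇒ D} → β ∘ (f ⊗₁ g) ≈ (g ⊗₁ f) ∘ β
    pentagon  : ∀ {A B C D} →
                α⇒ {A} {B} {C ⊗₀ D} ∘ α⇒ {A ⊗₀ B} {C} {D}
                  ≈ (id ⊗₁ α⇒) ∘ (α⇒ {A} {B ⊗₀ C} {D} ∘ (α⇒ ⊗₁ id))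
    triangle  : ∀ {A B} → (id ⊗₁ λ⇒) ∘ α⇒ {A} {𝟙} {B} ≈ (ρ⇒ ⊗₁ id)
    hexagon   : ∀ {A B C} →
                (id ⊗₁ β {A} {C}) ∘ (α⇒ {B} {A} {C} ∘ (β {A} {B} ⊗₁ id))
                  ≈ α⇒ {B} {C} {A} ∘ (β {A} {B ⊗₀ C} ∘ α⇒ {A} {B} {C})
    commutative : ∀ {A B} → β {B} {A} ∘ β {A} {B} ≈ id

module Copointed {o ℓ e} (𝒞 : SymmetricMonoidalCategory o ℓ e)
                 (X : SymmetricMonoidalCategory.Obj 𝒞)
                 (w : SymmetricMonoidalCategory._⇒_ 𝒞 X (SymmetricMonoidalCategory.𝟙 𝒞)) where
  open SymmetricMonoidalCategory 𝒞

  X^ : ℕ → Obj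
  X^ zero    = 𝟙
  X^ (suc n) = X^ n ⊗₀ X

  d : ∀ n → X^ (suc n) ⇒ X^ n
  d n = ρ⇒ ∘ (id ⊗₁ w)

  -- adjacent positions of X^{⊗m}: there are m-1 of them
  Adj : ℕ → Set
  Adj zero    = ⊥
  Adj (suc n) = Fin n

  -- swapAt m k : the symmetry of X^{⊗m} exchanging the factors at
  -- positions m-k-1 and m-k (1-based), i.e. k counts from the right
  swapAt : ∀ m → Adj m → X^ m ⇒ X^ m
  swapAt (suc (suc n)) zero    = α⇐ ∘ ((id ⊗₁ β) ∘ α⇒)
  swapAt (suc (suc n)) (suc k) = swapAt (suc n) k ⊗₁ id

  -- a symmetry of X^{⊗m} is given by a word in adjacent transpositions
  -- (every permutation is such a product; by coherence, the symmetry
  -- attached to a permutation is the composite of the adjacent swaps)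
  Sym : ℕ → Set
  Sym m = List (Adj m)

  ⟦_⟧ : ∀ {m} → Sym m → X^ m ⇒ X^ m
  ⟦ [] ⟧    = id
  ⟦ k ∷ s ⟧ = swapAt _ k ∘ ⟦ s ⟧

  lift : ∀ {N m} → N ≤′ m → X^ N ⇒ X^ N → X^ m ⇒ X^ m
  lift ≤′-refl      f = f
  lift (≤′-step p)  f = lift p f ⊗₁ id

  EqualisesSyms : ∀ {Z} n → Z ⇒ X^ n → Set e
  EqualisesSyms n g = ∀ (s t : Sym n) → ⟦ s ⟧ ∘ g ≈ ⟦ t ⟧ ∘ g

  record IsSymEqualiser (n : ℕ) (E : Obj) (eq : E ⇒ X^ n) : Set (o ⊔ ℓ ⊔ e) where
    field
      equalises : EqualisesSyms n eq
      factor    : ∀ {Z} (g : Z ⇒ X^ n) → EqualisesSyms n g → Z ⇒ E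
      factor-eq : ∀ {Z} (g : Z ⇒ X^ n) (p : EqualisesSyms n g) → eq ∘ factor g p ≈ g
      factor-unique : ∀ {Z} (g : Z ⇒ X^ n) (p : EqualisesSyms n g) (u : Z ⇒ E) →
                      eq ∘ u ≈ g → u ≈ factor g p

  IsDeleteCone : ∀ {Z} → (∀ n → Z ⇒ X^ n) → Set e
  IsDeleteCone g = ∀ n → d n ∘ g (suc n) ≈ g n

  record IsDeleteLimit (L : Obj) (π : ∀ n → L ⇒ X^ n) : Set (o ⊔ ℓ ⊔ e) where
    field
      cone     : IsDeleteCone π
      mediate  : ∀ {Z} (g : ∀ n → Z ⇒ X^ n) → IsDeleteCone g →
                 Σ (Z ⇒ L) λ u → (∀ n → π n ∘ u ≈ g n) ×
                   (∀ u′ → (∀ n → π n ∘ u′ ≈ g n) → u′ ≈ u)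

  -- s : L ⇒ L is the finitely supported symmetry σ̇ induced by σ ∈ Sym N:
  -- π_{≤m} ∘ σ̇ = σ^{↑m} ∘ π_{≤m} for all m ≥ N
  IsFinSuppSym : ∀ {L} (π : ∀ n → L ⇒ X^ n) (N : ℕ) (σ : Sym N) → L ⇒ L → Set (e)
  IsFinSuppSym π N σ s = ∀ m (p : N ≤′ m) → π m ∘ s ≈ lift p ⟦ σ ⟧ ∘ π m

-- Every symmetry of X^{⊗n} extends, through the limit X^ω, to a finitely
-- supported symmetry of X^ω: its components are obtained by acting on enough
-- factors and deleting the surplus, and they form a cone because deletion of
-- the last factor commutes with symmetries of the first ones. An invariant f
-- therefore has π_{≤n} ∘ f fixed by every symmetry of X^{⊗n}. The factorisations
-- through the equalisers form a cone on the draw-and-delete chain by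
-- uniqueness of factorisation, since DD_n is induced by the delete map d_n.
module Submission where

open import Defs
open import Data.Nat using (ℕ; suc; _+_; _≤′_; ≤′-refl; ≤′-step; ≤′-reflexive)
open import Data.Nat.Properties using (≡-irrelevant; 1+n≰n; ≤′⇒≤; ≤′-trans; s≤′s; m≤′m+n; n≤′m+n)
open import Data.Product using (Σ; _,_)
open import Data.Empty using (⊥-elim)
open import Relation.Binary using (Setoid; IsEquivalence)
open import Relation.Binary.Definitions using (Irrelevant)
open import Relation.Binary.PropositionalEquality using (refl; cong)
import Relation.Binary.Reasoning.Setoid as SetoidReasoning

≤′-irrelevant : Irrelevant _≤′_
≤′-irrelevant (≤′-reflexive p) (≤′-reflexive q) = cong ≤′-reflexive (≡-irrelevant p q)
≤′-irrelevant (≤′-reflexive refl) (≤′-step q) = ⊥-elim (1+n≰n (≤′⇒≤ q))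
≤′-irrelevant (≤′-step p) (≤′-reflexive refl) = ⊥-elim (1+n≰n (≤′⇒≤ p))
≤′-irrelevant (≤′-step p) (≤′-step q) = cong ≤′-step (≤′-irrelevant p q)

module DeleteChain {o ℓ e} (𝒞 : SymmetricMonoidalCategory o ℓ e)
  (X : SymmetricMonoidalCategory.Obj 𝒞)
  (w : SymmetricMonoidalCategory._⇒_ 𝒞 X (SymmetricMonoidalCategory.𝟙 𝒞)) where
  open SymmetricMonoidalCategory 𝒞
  open Copointed 𝒞 X w

  hom-setoid : Obj → Obj → Setoid ℓ e
  hom-setoid A B = record { Carrier = A ⇒ B ; _≈_ = _≈_ ; isEquivalence = equiv }

  private
    module ≈ {A B : Obj} = IsEquivalence (equiv {A} {B})

  infixr 4 _⟩∘⟨refl refl⟩∘⟨_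

  _⟩∘⟨refl : ∀ {A B C} {f h : B ⇒ C} {g : A ⇒ B} → f ≈ h → f ∘ g ≈ h ∘ g
  p ⟩∘⟨refl = ∘-resp-≈ p ≈.refl

  refl⟩∘⟨_ : ∀ {A B C} {f : B ⇒ C} {g i : A ⇒ B} → g ≈ i → f ∘ g ≈ f ∘ i
  refl⟩∘⟨ p = ∘-resp-≈ ≈.refl p

  del : ∀ {m K} → m ≤′ K → X^ K ⇒ X^ m
  del ≤′-refl         = id
  del (≤′-step {K} q) = del q ∘ d K

  d-natural : ∀ m (g : X^ m ⇒ X^ m) → d m ∘ (g ⊗₁ id) ≈ g ∘ d m
  d-natural m g = begin
      (ρ⇒ ∘ (id ⊗₁ w)) ∘ (g ⊗₁ id)  ≈⟨ assoc ⟩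
      ρ⇒ ∘ ((id ⊗₁ w) ∘ (g ⊗₁ id))  ≈⟨ refl⟩∘⟨ ≈.sym ⊗-homomorphism ⟩
      ρ⇒ ∘ ((id ∘ g) ⊗₁ (w ∘ id))   ≈⟨ refl⟩∘⟨ ⊗-resp-≈ (≈.trans identityˡ (≈.sym identityʳ))
                                                         (≈.trans identityʳ (≈.sym identityˡ)) ⟩
      ρ⇒ ∘ ((g ∘ id) ⊗₁ (id ∘ w))   ≈⟨ refl⟩∘⟨ ⊗-homomorphism ⟩
      ρ⇒ ∘ ((g ⊗₁ id) ∘ (id ⊗₁ w))  ≈⟨ ≈.sym assoc ⟩
      (ρ⇒ ∘ (g ⊗₁ id)) ∘ (id ⊗₁ w)  ≈⟨ ρ-natural ⟩∘⟨refl ⟩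
      (g ∘ ρ⇒) ∘ (id ⊗₁ w)          ≈⟨ assoc ⟩
      g ∘ (ρ⇒ ∘ (id ⊗₁ w))          ∎
    where open SetoidReasoning (hom-setoid _ _)

  d∘del-s≤′s : ∀ {m K} (q : m ≤′ K) → d m ∘ del (s≤′s q) ≈ del q ∘ d K
  d∘del-s≤′s ≤′-refl     = ≈.trans identityʳ (≈.sym identityˡ)
  d∘del-s≤′s (≤′-step q) = ≈.trans (≈.sym assoc) (d∘del-s≤′s q ⟩∘⟨refl)

  del-lift : ∀ {N m K} (h : X^ N ⇒ X^ N) (p : N ≤′ m) (q : m ≤′ K) →
             del q ∘ lift (≤′-trans p q) h ≈ lift p h ∘ del q
  del-lift h p ≤′-refl = ≈.trans identityˡ (≈.sym identityʳ)
  del-lift h p (≤′-step {K} q) = begin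
      (del q ∘ d K) ∘ (lift (≤′-trans p q) h ⊗₁ id)  ≈⟨ assoc ⟩
      del q ∘ (d K ∘ (lift (≤′-trans p q) h ⊗₁ id))  ≈⟨ refl⟩∘⟨ d-natural K _ ⟩
      del q ∘ (lift (≤′-trans p q) h ∘ d K)          ≈⟨ ≈.sym assoc ⟩
      (del q ∘ lift (≤′-trans p q) h) ∘ d K          ≈⟨ del-lift h p q ⟩∘⟨refl ⟩
      (lift p h ∘ del q) ∘ d K                       ≈⟨ assoc ⟩
      lift p h ∘ (del q ∘ d K)                       ∎
    where open SetoidReasoning (hom-setoid _ _)

  del-cone : ∀ {Z} {g : ∀ n → Z ⇒ X^ n} → IsDeleteCone g →
             ∀ {m K} (q : m ≤′ K) → del q ∘ g K ≈ g m
  del-cone cone ≤′-refl     = identityˡ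
  del-cone cone (≤′-step q) = ≈.trans assoc (≈.trans (refl⟩∘⟨ cone _) (del-cone cone q))

  delete-cone-∘ : ∀ {Y Z} {g : ∀ n → Y ⇒ X^ n} → IsDeleteCone g →
                  (f : Z ⇒ Y) → IsDeleteCone (λ n → g n ∘ f)
  delete-cone-∘ cone f n = ≈.trans (≈.sym assoc) (cone n ⟩∘⟨refl)

  module _ {L : Obj} {π : ∀ n → L ⇒ X^ n} (lim : IsDeleteLimit L π) where
    open IsDeleteLimit lim

    module _ {N : ℕ} (h : X^ N ⇒ X^ N) where

      extension-component : ∀ m → L ⇒ X^ m
      extension-component m = del (m≤′m+n m N) ∘ (lift (n≤′m+n m N) h ∘ π (m + N))

      extension-component-cone : IsDeleteCone extension-component
      extension-component-cone m = begin
          d m ∘ (del (s≤′s q) ∘ ((H ⊗₁ id) ∘ π (suc K)))  ≈⟨ ≈.sym assoc ⟩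
          (d m ∘ del (s≤′s q)) ∘ ((H ⊗₁ id) ∘ π (suc K))  ≈⟨ d∘del-s≤′s q ⟩∘⟨refl ⟩
          (del q ∘ d K) ∘ ((H ⊗₁ id) ∘ π (suc K))         ≈⟨ assoc ⟩
          del q ∘ (d K ∘ ((H ⊗₁ id) ∘ π (suc K)))         ≈⟨ refl⟩∘⟨ ≈.sym assoc ⟩
          del q ∘ ((d K ∘ (H ⊗₁ id)) ∘ π (suc K))         ≈⟨ refl⟩∘⟨ (d-natural K H ⟩∘⟨refl) ⟩
          del q ∘ ((H ∘ d K) ∘ π (suc K))                 ≈⟨ refl⟩∘⟨ assoc ⟩
          del q ∘ (H ∘ (d K ∘ π (suc K)))                 ≈⟨ refl⟩∘⟨ refl⟩∘⟨ cone K ⟩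
          del q ∘ (H ∘ π K)                               ∎
        where
          open SetoidReasoning (hom-setoid _ _)
          K = m + N
          q = m≤′m+n m N
          H = lift (n≤′m+n m N) h

      extension-component-lift : ∀ m (p : N ≤′ m) → extension-component m ≈ lift p h ∘ π m
      extension-component-lift m p
        rewrite ≤′-irrelevant (n≤′m+n m N) (≤′-trans p (m≤′m+n m N)) = begin
          del q ∘ (lift (≤′-trans p q) h ∘ π (m + N))  ≈⟨ ≈.sym assoc ⟩
          (del q ∘ lift (≤′-trans p q) h) ∘ π (m + N)  ≈⟨ del-lift h p q ⟩∘⟨refl ⟩
          (lift p h ∘ del q) ∘ π (m + N)               ≈⟨ assoc ⟩
          lift p h ∘ (del q ∘ π (m + N))               ≈⟨ refl⟩∘⟨ del-cone cone q ⟩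
          lift p h ∘ π m                               ∎
        where
          open SetoidReasoning (hom-setoid _ _)
          q = m≤′m+n m N

      extend : Σ (L ⇒ L) λ s → ∀ m (p : N ≤′ m) → π m ∘ s ≈ lift p h ∘ π m
      extend with mediate extension-component extension-component-cone
      ... | s , s-components , _ =
        s , λ m p → ≈.trans (s-components m) (extension-component-lift m p)

    invariant-equalisesSyms : ∀ {Z} (f : Z ⇒ L) →
      (∀ N (σ : Sym N) (σ̇ : L ⇒ L) → IsFinSuppSym π N σ σ̇ → σ̇ ∘ f ≈ f) →
      ∀ n → EqualisesSyms n (π n ∘ f)
    invariant-equalisesSyms f invariant n s t = ≈.trans (fixed s) (≈.sym (fixed t))
      where
        fixed : ∀ (σ : Sym n) → ⟦ σ ⟧ ∘ (π n ∘ f) ≈ π n ∘ f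
        fixed σ with extend ⟦ σ ⟧
        ... | σ̇ , σ̇-supported = begin
            ⟦ σ ⟧ ∘ (π n ∘ f)  ≈⟨ ≈.sym assoc ⟩
            (⟦ σ ⟧ ∘ π n) ∘ f  ≈⟨ ≈.sym (σ̇-supported n ≤′-refl) ⟩∘⟨refl ⟩
            (π n ∘ σ̇) ∘ f      ≈⟨ assoc ⟩
            π n ∘ (σ̇ ∘ f)      ≈⟨ refl⟩∘⟨ invariant n σ σ̇ σ̇-supported ⟩
            π n ∘ f            ∎
          where open SetoidReasoning (hom-setoid _ _)

  module _ {M : ℕ → Obj} {eq : ∀ n → M n ⇒ X^ n}
           (isEq : ∀ n → IsSymEqualiser n (M n) (eq n))
           {DD : ∀ n → M (suc n) ⇒ M n} (DD-eq : ∀ n → eq n ∘ DD n ≈ d n ∘ eq (suc n)) where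
    open IsSymEqualiser

    factor-cone : ∀ {Z} (g : ∀ n → Z ⇒ X^ n) → IsDeleteCone g →
                  (eqs : ∀ n → EqualisesSyms n (g n)) →
                  ∀ n → DD n ∘ factor (isEq (suc n)) (g (suc n)) (eqs (suc n))
                          ≈ factor (isEq n) (g n) (eqs n)
    factor-cone g cone eqs n = factor-unique (isEq n) (g n) (eqs n) _ (begin
        eq n ∘ (DD n ∘ g⁺†)        ≈⟨ ≈.sym assoc ⟩
        (eq n ∘ DD n) ∘ g⁺†        ≈⟨ DD-eq n ⟩∘⟨refl ⟩
        (d n ∘ eq (suc n)) ∘ g⁺†   ≈⟨ assoc ⟩
        d n ∘ (eq (suc n) ∘ g⁺†)   ≈⟨ refl⟩∘⟨ factor-eq (isEq (suc n)) _ _ ⟩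
        d n ∘ g (suc n)            ≈⟨ cone n ⟩
        g n                        ∎)
      where
        open SetoidReasoning (hom-setoid _ _)
        g⁺† = factor (isEq (suc n)) (g (suc n)) (eqs (suc n))

proposition2p12 : ∀ {o ℓ e} (𝒞 : SymmetricMonoidalCategory o ℓ e) →
    let open SymmetricMonoidalCategory 𝒞 in
    (X : Obj) (w : X ⇒ 𝟙) →
    let open Copointed 𝒞 X w in
    (M : ℕ → Obj) (eq : ∀ n → M n ⇒ X^ n) (isEq : ∀ n → IsSymEqualiser n (M n) (eq n)) →
    (Xω : Obj) (π : ∀ n → Xω ⇒ X^ n) → IsDeleteLimit Xω π →
    (DD : ∀ n → M (suc n) ⇒ M n) → (∀ n → eq n ∘ DD n ≈ d n ∘ eq (suc n)) →
    ∀ {Z} (f : Z ⇒ Xω) →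
    (∀ N (σ : Sym N) (σ̇ : Xω ⇒ Xω) → IsFinSuppSym π N σ σ̇ → σ̇ ∘ f ≈ f) →
    Σ (∀ n → EqualisesSyms n (π n ∘ f)) λ eqs →
    ∀ n → DD n ∘ IsSymEqualiser.factor (isEq (suc n)) (π (suc n) ∘ f) (eqs (suc n))
    ≈ IsSymEqualiser.factor (isEq n) (π n ∘ f) (eqs n)
proposition2p12 𝒞 X w M eq isEq Xω π lim DD DD-eq f invariant =
  equalises , factor-cone isEq DD-eq (λ n → π n ∘ f) (delete-cone-∘ (IsDeleteLimit.cone lim) f) equalises
  where
    open SymmetricMonoidalCategory 𝒞
    open Copointed 𝒞 X w
    open DeleteChain 𝒞 X w

    equalises : ∀ n → EqualisesSyms n (π n ∘ f)
    equalises = invariant-equalisesSyms lim f invariant
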